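{- Let $a,b,k$ be non-negative integers with $b\ge1$ and $2a+2b-1\le k$. For an integer $c$, let $\mathcal{Z}^e_{a,c,k}$ be the set of generalised frequency sequences $(f_i)_{i\in\mathbb Z}$ such that $f_i+f_{i+1}\le k$ for all $i\ge0$, $f_i=0$ for all $i<0$, $f_0\le 2a$ and $2f_0+f_1\le k-2c+2a$, and $f_i$ is even whenever $i$ is even; and let $\widetilde{\mathcal{Z}}^e_{a,b,k}$ be the set defined by the same conditions except that $2f_0+f_1\le k-2b+2a+1$. Then \[ (1+q)\sum_{f\in\widetilde{\mathcal{Z}}^e_{a,b,k}}q^{|f|}=\sum_{f\in\mathcal{Z}^e_{a,b-1,k}}q^{|f|}+q\sum_{f\in\mathcal{Z}^e_{a,b,k}}q^{|f|}. \]
   Context: A generalised frequency sequence is a sequence $(f_i)_{i\in\mathbb Z}$ of non-negative integers with finitely many non-zero terms ($f_i$ = multiplicity of the part $i$), of weight $|f|=\sum_i if_i$. -}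

module Defs where

open import Data.Nat as ℕ using (ℕ; zero; suc)
import Data.Nat.Divisibility as ℕD
open import Data.Integer as ℤ using (ℤ; +_; -[1+_]; ∣_∣)
import Data.Integer.Divisibility as ℤD
open import Data.Fin using (Fin)
open import Data.Product using (Σ; _×_; proj₁)
open import Relation.Binary.Bundles using (Setoid)
open import Relation.Binary.PropositionalEquality as ≡ using (_≡_)
open import Function.Bundles using (Inverse)
open import Level using (0ℓ)

record GFS : Set where
  field
    freq   : ℤ → ℕ
    bound  : ℕ
    finite : ∀ i → bound ℕ.< ∣ i ∣ → freq i ≡ 0
open GFS public

sumℤ : ℕ → (ℕ → ℤ) → ℤ
sumℤ zero    g = + 0
sumℤ (suc m) g = sumℤ m g ℤ.+ g m

-- weight |f| = Σ_i i f_i, the sum taken over the range -B ≤ i ≤ B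
weight : GFS → ℤ
weight f = sumℤ (suc (2 ℕ.* B)) (λ j → (+ j ℤ.- + B) ℤ.* + freq f (+ j ℤ.- + B))
  where B = bound f

CommonCond : (a k : ℕ) → GFS → Set
CommonCond a k f =
    (∀ (i : ℕ) → freq f (+ i) ℕ.+ freq f (+ suc i) ℕ.≤ k)
  × (∀ (i : ℕ) → freq f -[1+ i ] ≡ 0)
  × (freq f (+ 0) ℕ.≤ 2 ℕ.* a)
  × (∀ (i : ℤ) → (+ 2) ℤD.∣ i → 2 ℕD.∣ freq f i)

twoF0F1 : GFS → ℤ
twoF0F1 f = + (2 ℕ.* freq f (+ 0) ℕ.+ freq f (+ 1))

InZe : (a : ℕ) (c : ℤ) (k : ℕ) → GFS → Set
InZe a c k f = CommonCond a k f × (twoF0F1 f ℤ.≤ + k ℤ.- + 2 ℤ.* c ℤ.+ + 2 ℤ.* + a)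

InZeTilde : (a b k : ℕ) → GFS → Set
InZeTilde a b k f =
  CommonCond a k f × (twoF0F1 f ℤ.≤ + k ℤ.- + 2 ℤ.* + b ℤ.+ + 2 ℤ.* + a ℤ.+ + 1)

-- The elements f of a set P with |f| + s = n (i.e. those contributing to the
-- coefficient of q^n in q^s Σ_{f∈P} q^{|f|}), as a setoid where sequences are
-- identified when their frequencies agree pointwise.
WeightSlice : (P : GFS → Set) (s n : ℕ) → Setoid 0ℓ 0ℓ
WeightSlice P s n = record
  { Carrier       = Σ GFS (λ f → P f × (weight f ℤ.+ + s ≡ + n))
  ; _≈_           = λ x y → ∀ i → freq (proj₁ x) i ≡ freq (proj₁ y) i
  ; isEquivalence = record
    { refl  = λ i → ≡.refl
    ; sym   = λ p i → ≡.sym (p i)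
    ; trans = λ p q i → ≡.trans (p i) (q i)
    }
  }

HasSize : Setoid 0ℓ 0ℓ → ℕ → Set
HasSize S m = Inverse (≡.setoid (Fin m)) S

module Submission where

-- Write T = k + 2a + 1 − 2b and call 2f₀ + f₁ the level of f.  Besides the common conditions,
-- membership in Z̃ᵉ_{a,b,k}, Zᵉ_{a,b−1,k} and Zᵉ_{a,b,k} asks for the level to be ≤ T, ≤ T + 1
-- and < T respectively.  So Zᵉ_{a,b−1,k} is Z̃ᵉ_{a,b,k} plus the sequences of level T + 1,
-- Z̃ᵉ_{a,b,k} is Zᵉ_{a,b,k} plus the sequences of level T, and the identity reduces to a bijection
-- from level T to level T + 1 raising the weight by one: increase f₁ by one.  This keeps
-- f₀ + f₁ ≤ k and f₁ + f₂ ≤ k, since neither is an equality at level T (f₀ and f₂ are even, T + k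
-- is odd); it is invertible since f₁ ≥ 1 at level T + 1, because 2f₀ ≤ 4a ≤ T by 2a + 2b − 1 ≤ k.
-- Each weight slice is finite, so comparing coefficients amounts to comparing sizes.

open import Defs
open import Data.Nat using (ℕ; _+_; _*_; _∸_; _≤_)
open import Data.Integer as ℤ using (+_)
open import Data.Product using (Σ; _×_)
open import Relation.Binary.PropositionalEquality using (_≡_)

open import Data.Empty using (⊥; ⊥-elim)
open import Data.Fin using (Fin; zero; suc; toℕ; fromℕ<)
open import Data.Fin.Permutation using (↔⇒≡)
open import Data.Fin.Properties using (+↔⊎; *↔×; toℕ-fromℕ<; toℕ-injective)
open import Data.Integer using (ℤ; -[1+_]; ∣_∣)
open import Data.Integer.Divisibility using () renaming (_∣_ to _ℤ∣_)
import Data.Integer.Properties as ℤ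
open import Data.Integer.Tactic.RingSolver using () renaming (solve-∀ to ℤ-solve-∀)
open import Data.Nat using (zero; suc; pred; _^_; _<_; z≤n; s≤s; s≤s⁻¹; ≢-nonZero)
open import Data.Nat.Divisibility using (_∣_; _∣?_; _∣0; ∣1⇒≡1; ∣-refl; m∣m*n; ∣m∣n⇒∣m+n; ∣m+n∣m⇒∣n)
import Data.Nat.Properties as ℕ
open import Algebra.Properties.CommutativeSemigroup ℕ.+-commutativeSemigroup using (xy∙z≈xz∙y; x∙yz≈xz∙y)
open import Data.Nat.Tactic.RingSolver using (solve-∀)
open import Data.Product as Product using (_,_; proj₁; proj₂; uncurry)
open import Data.Product.Function.NonDependent.Propositional using (_×-↔_)
open import Data.Sum as Sum using (_⊎_; inj₁; inj₂)
open import Data.Sum.Function.Setoid using (_⊎-inverse_)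
open import Data.Sum.Relation.Binary.Pointwise as Pointwise using (_⊎ₛ_; Pointwise-≡↔≡)
open import Data.Vec using (Vec; []; _∷_; uncons)
open import Function.Base using (_∘_)
open import Function.Bundles using (Inverse; Equivalence; _↔_; _⇔_; mk↔ₛ′; mk⇔)
import Function.Consequences.Setoid as Consequences
open import Function.Construct.Composition using (inverse; _↔-∘_)
open import Function.Construct.Identity using (↔-id)
open import Function.Construct.Symmetry using (↔-sym)
import Function.Construct.Symmetry as Symmetry
open import Function.Definitions using (Congruent; StrictlyInverseˡ; StrictlyInverseʳ)
open import Level using (0ℓ)
import Relation.Binary.Construct.On as On
open import Relation.Binary.Bundles using (Setoid)
open import Relation.Binary.Definitions using (_Respects_)
open import Relation.Binary.PropositionalEquality as ≡ using (_≢_; _≗_; refl; cong; cong₂; sym; trans; subst; subst₂; module ≡-Reasoning)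
open import Relation.Nullary using (Dec; yes; no; ¬_; contradiction)
import Relation.Nullary.Decidable as Dec
open import Relation.Nullary.Decidable using (_×-dec_; _→-dec_)
open import Relation.Unary using (Pred; Decidable; _⊆_; _∪_)

-- Finite setoids

module _ {S T : Setoid 0ℓ 0ℓ} where
  private
    module S = Setoid S
    module T = Setoid T

  mkInverse : (to : S.Carrier → T.Carrier) (from : T.Carrier → S.Carrier) →
              Congruent S._≈_ T._≈_ to → Congruent T._≈_ S._≈_ from →
              StrictlyInverseˡ T._≈_ to from → StrictlyInverseʳ S._≈_ to from →
              Inverse S T
  mkInverse to from to-cong from-cong invˡ invʳ = record
    { to        = to
    ; from      = from
    ; to-cong   = to-cong
    ; from-cong = from-cong
    ; inverse   = Consequences.strictlyInverseˡ⇒inverseˡ S T to-cong invˡ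
                , Consequences.strictlyInverseʳ⇒inverseʳ S T from-cong invʳ
    }

HasSize-⊎ : ∀ {S T m n} → HasSize S m → HasSize T n → HasSize (S ⊎ₛ T) (m + n)
HasSize-⊎ {m = m} {n} |S| |T| =
  inverse +↔⊎ (inverse (Symmetry.inverse (Pointwise-≡↔≡ (Fin m) (Fin n))) (|S| ⊎-inverse |T|))

HasSize-unique : ∀ {S m n} → HasSize S m → HasSize S n → m ≡ n
HasSize-unique |S|₁ |S|₂ = ↔⇒≡ (inverse |S|₁ (Symmetry.inverse |S|₂))

size-transport : ∀ {S T m n} → Inverse S T → HasSize S m → HasSize T n → m ≡ n
size-transport S↔T |S| = HasSize-unique (inverse |S| S↔T)

Restrict : (A : Set) → Pred A 0ℓ → Setoid 0ℓ 0ℓ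
Restrict A Q = On.setoid (≡.setoid A) (proj₁ {B = Q})

count : ∀ {N} {Q : Pred (Fin N) 0ℓ} → Decidable Q → ℕ
count {zero}  Q? = 0
count {suc N} Q? with Q? zero
... | yes _ = suc (count (λ i → Q? (suc i)))
... | no  _ = count (λ i → Q? (suc i))

module _ {N c} {Q : Pred (Fin (suc N)) 0ℓ}
         (|Q∘suc| : HasSize (Restrict (Fin N) (λ i → Q (suc i))) c) where
  private module I = Inverse |Q∘suc|

  HasSize-restrict-suc-∈ : Q zero → HasSize (Restrict (Fin (suc N)) Q) (suc c)
  HasSize-restrict-suc-∈ q₀ = mkInverse to from (cong (proj₁ ∘ to)) from-cong invˡ invʳ
    where
    to : Fin (suc c) → Σ (Fin (suc N)) Q
    to zero    = zero , q₀
    to (suc i) = suc (proj₁ (I.to i)) , proj₂ (I.to i)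
    from : Σ (Fin (suc N)) Q → Fin (suc c)
    from (zero  , _) = zero
    from (suc j , q) = suc (I.from (j , q))
    from-cong : ∀ {x y} → proj₁ x ≡ proj₁ y → from x ≡ from y
    from-cong {zero  , _} {zero   , _} refl = refl
    from-cong {suc j , _} {suc .j , _} refl = cong suc (I.from-cong refl)
    invˡ : ∀ y → proj₁ (to (from y)) ≡ proj₁ y
    invˡ (zero  , _) = refl
    invˡ (suc j , q) = cong suc (I.strictlyInverseˡ (j , q))
    invʳ : ∀ i → from (to i) ≡ i
    invʳ zero    = refl
    invʳ (suc i) = cong suc (I.strictlyInverseʳ i)

  HasSize-restrict-suc-∉ : ¬ Q zero → HasSize (Restrict (Fin (suc N)) Q) c
  HasSize-restrict-suc-∉ ¬q₀ =
    mkInverse to from (cong (proj₁ ∘ to)) from-cong invˡ I.strictlyInverseʳ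
    where
    to : Fin c → Σ (Fin (suc N)) Q
    to i = suc (proj₁ (I.to i)) , proj₂ (I.to i)
    from : Σ (Fin (suc N)) Q → Fin c
    from (zero  , q) = ⊥-elim (¬q₀ q)
    from (suc j , q) = I.from (j , q)
    from-cong : ∀ {x y} → proj₁ x ≡ proj₁ y → from x ≡ from y
    from-cong {zero  , q} {zero   , _} refl = ⊥-elim (¬q₀ q)
    from-cong {suc j , _} {suc .j , _} refl = I.from-cong refl
    invˡ : ∀ y → proj₁ (to (from y)) ≡ proj₁ y
    invˡ (zero  , q) = ⊥-elim (¬q₀ q)
    invˡ (suc j , q) = cong suc (I.strictlyInverseˡ (j , q))

HasSize-restrict-Fin : ∀ {N} {Q : Pred (Fin N) 0ℓ} (Q? : Decidable Q) →
                       HasSize (Restrict (Fin N) Q) (count Q?)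
HasSize-restrict-Fin {zero}  Q? = mkInverse (λ ()) (λ ()) (λ { {()} }) (λ { {() , _} }) (λ ()) (λ ())
HasSize-restrict-Fin {suc N} Q? with Q? zero
... | yes q₀ = HasSize-restrict-suc-∈ (HasSize-restrict-Fin (λ i → Q? (suc i))) q₀
... | no ¬q₀ = HasSize-restrict-suc-∉ (HasSize-restrict-Fin (λ i → Q? (suc i))) ¬q₀

restrict-finite : ∀ {A N} {Q : Pred A 0ℓ} → A ↔ Fin N → Decidable Q → Σ ℕ (HasSize (Restrict A Q))
restrict-finite {A} {N} {Q} A↔Fin Q? =
  _ , inverse (HasSize-restrict-Fin (λ i → Q? (E.from i))) restrict-along
  where
  module E = Inverse A↔Fin
  restrict-along : Inverse (Restrict (Fin N) (λ i → Q (E.from i))) (Restrict A Q)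
  restrict-along = mkInverse (λ (i , q) → E.from i , q)
    (λ (x , q) → E.to x , subst Q (sym (E.strictlyInverseʳ x)) q)
    (cong E.from) (cong E.to)
    (λ (x , _) → E.strictlyInverseʳ x) (λ (i , _) → E.strictlyInverseˡ i)

Vec↔Fin^ : ∀ {B} L → Vec (Fin B) L ↔ Fin (B ^ L)
Vec↔Fin^ zero    = mk↔ₛ′ (λ _ → zero) (λ _ → []) (λ { zero → refl }) (λ { [] → refl })
Vec↔Fin^ (suc L) = ↔-sym *↔× ↔-∘ ((↔-id _ ×-↔ Vec↔Fin^ L) ↔-∘ uncons↔)
  where
  uncons↔ : Vec _ (suc L) ↔ (_ × Vec _ L)
  uncons↔ = mk↔ₛ′ uncons (uncurry _∷_) (λ _ → refl) (λ { (_ ∷ _) → refl })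

-- Weights

_≋_ : GFS → GFS → Set
f ≋ g = freq f ≗ freq g

mult : GFS → ℕ → ℕ
mult f j = freq f (+ j)

NoNegativeParts : Pred GFS 0ℓ
NoNegativeParts f = ∀ i → freq f -[1+ i ] ≡ 0

mult-beyond-bound : ∀ f {j} → bound f < j → mult f j ≡ 0
mult-beyond-bound f {j} = finite f (+ j)

moment : (ℕ → ℕ) → ℕ → ℕ
moment g zero    = 0
moment g (suc C) = moment g C + C * g C

moment-cong : ∀ {g h} C → (∀ {j} → j < C → g j ≡ h j) → moment g C ≡ moment h C
moment-cong zero    g≡h = refl
moment-cong (suc C) g≡h =
  cong₂ _+_ (moment-cong C (λ j<C → g≡h (ℕ.m<n⇒m<1+n j<C))) (cong (C *_) (g≡h (ℕ.n<1+n C)))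

moment-stable : ∀ {g C D} → C ≤ D → (∀ {j} → C ≤ j → g j ≡ 0) → moment g D ≡ moment g C
moment-stable {g} {C} {zero}  z≤n    vanish = refl
moment-stable {g} {C} {suc D} C≤1+D vanish with ℕ.m≤n⇒m<n∨m≡n C≤1+D
... | inj₂ refl  = refl
... | inj₁ C<1+D = begin
  moment g D + D * g D ≡⟨ cong (λ x → moment g D + D * x) (vanish (s≤s⁻¹ C<1+D)) ⟩
  moment g D + D * 0   ≡⟨ cong (λ x → moment g D + x) (ℕ.*-zeroʳ D) ⟩
  moment g D + 0       ≡⟨ ℕ.+-identityʳ _ ⟩
  moment g D           ≡⟨ moment-stable (s≤s⁻¹ C<1+D) vanish ⟩
  moment g C           ∎
  where open ≡-Reasoning

term≤moment : ∀ g {j C} → j < C → j * g j ≤ moment g C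
term≤moment g {j} {suc C} j<1+C with ℕ.m<1+n⇒m<n∨m≡n j<1+C
... | inj₁ j<C  = ℕ.≤-trans (term≤moment g j<C) (ℕ.m≤m+n _ _)
... | inj₂ refl = ℕ.m≤n+m _ _

moment-update : ∀ {g h i} C → i < C → (∀ {j} → j ≢ i → g j ≡ h j) →
                moment g C + i * h i ≡ moment h C + i * g i
moment-update {g} {h} {i} (suc C) i<1+C g≡h with ℕ.m<1+n⇒m<n∨m≡n i<1+C
... | inj₁ i<C = begin
  moment g C + C * g C + i * h i ≡⟨ xy∙z≈xz∙y (moment g C) _ _ ⟩
  moment g C + i * h i + C * g C ≡⟨ cong₂ _+_ (moment-update C i<C g≡h) (cong (C *_) (g≡h (ℕ.>⇒≢ i<C))) ⟩
  moment h C + i * g i + C * h C ≡⟨ xy∙z≈xz∙y (moment h C) _ _ ⟩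
  moment h C + C * h C + i * g i ∎
  where open ≡-Reasoning
... | inj₂ refl = begin
  moment g C + C * g C + C * h C ≡⟨ xy∙z≈xz∙y (moment g C) _ _ ⟩
  moment g C + C * h C + C * g C ≡⟨ cong (λ m → m + C * h C + C * g C) (moment-cong C (g≡h ∘ ℕ.<⇒≢)) ⟩
  moment h C + C * h C + C * g C ∎
  where open ≡-Reasoning

sumℤ-cong : ∀ m {g h} → (∀ {j} → j < m → g j ≡ h j) → sumℤ m g ≡ sumℤ m h
sumℤ-cong zero    g≡h = refl
sumℤ-cong (suc m) g≡h =
  cong₂ ℤ._+_ (sumℤ-cong m (λ j<m → g≡h (ℕ.m<n⇒m<1+n j<m))) (g≡h (ℕ.n<1+n m))

sumℤ-+ : ∀ m p g → sumℤ (m + p) g ≡ sumℤ m g ℤ.+ sumℤ p (λ j → g (m + j))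
sumℤ-+ m zero    g = trans (cong (λ x → sumℤ x g) (ℕ.+-identityʳ m)) (sym (ℤ.+-identityʳ _))
sumℤ-+ m (suc p) g = begin
  sumℤ (m + suc p) g                                    ≡⟨ cong (λ x → sumℤ x g) (ℕ.+-suc m p) ⟩
  sumℤ (m + p) g ℤ.+ g (m + p)                          ≡⟨ cong (ℤ._+ g (m + p)) (sumℤ-+ m p g) ⟩
  sumℤ m g ℤ.+ sumℤ p (λ j → g (m + j)) ℤ.+ g (m + p)   ≡⟨ ℤ.+-assoc (sumℤ m g) _ _ ⟩
  sumℤ m g ℤ.+ (sumℤ p (λ j → g (m + j)) ℤ.+ g (m + p)) ∎
  where open ≡-Reasoning

sumℤ-zeros : ∀ m {g} → (∀ {j} → j < m → g j ≡ + 0) → sumℤ m g ≡ + 0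
sumℤ-zeros zero    g≡0 = refl
sumℤ-zeros (suc m) g≡0 =
  cong₂ ℤ._+_ (sumℤ-zeros m (λ j<m → g≡0 (ℕ.m<n⇒m<1+n j<m))) (g≡0 (ℕ.n<1+n m))

sumℤ-moment : ∀ m g → sumℤ m (λ j → + (j * g j)) ≡ + moment g m
sumℤ-moment zero    g = refl
sumℤ-moment (suc m) g = cong (ℤ._+ + (m * g m)) (sumℤ-moment m g)

negative-index : ∀ {j B} → j < B → Σ ℕ λ i → + j ℤ.- + B ≡ -[1+ i ]
negative-index {j} {B} j<B with B ∸ j | ℕ.m<n⇒0<n∸m j<B | ℤ.⊖-< j<B
... | suc i | _ | j⊖B≡-[1+i] = i , trans (ℤ.m-n≡m⊖n j B) j⊖B≡-[1+i]

shifted-index : ∀ B j → + (B + j) ℤ.- + B ≡ + j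
shifted-index B j = begin
  + (B + j) ℤ.- + B ≡⟨ ℤ.m-n≡m⊖n (B + j) B ⟩
  (B + j) ℤ.⊖ B     ≡⟨ ℤ.⊖-≥ (ℕ.m≤m+n B j) ⟩
  + (B + j ∸ B)     ≡⟨ cong +_ (ℕ.m+n∸m≡n B j) ⟩
  + j               ∎
  where open ≡-Reasoning

weightℕ : GFS → ℕ
weightℕ f = moment (mult f) (suc (bound f))

weight≡weightℕ : ∀ f → NoNegativeParts f → weight f ≡ + weightℕ f
weight≡weightℕ f noNeg = begin
  sumℤ (suc (2 * B)) term                           ≡⟨ cong (λ m → sumℤ m term) 1+2B≡B+[1+B] ⟩
  sumℤ (B + suc B) term                             ≡⟨ sumℤ-+ B (suc B) term ⟩
  sumℤ B term ℤ.+ sumℤ (suc B) (λ j → term (B + j)) ≡⟨ cong₂ ℤ._+_ (sumℤ-zeros B negative-term)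
                                                                    (sumℤ-cong (suc B) (λ {j} _ → shifted-term j)) ⟩
  + 0 ℤ.+ sumℤ (suc B) (λ j → + (j * mult f j))     ≡⟨ ℤ.+-identityˡ _ ⟩
  sumℤ (suc B) (λ j → + (j * mult f j))             ≡⟨ sumℤ-moment (suc B) (mult f) ⟩
  + weightℕ f                                       ∎
  where
  open ≡-Reasoning
  B = bound f
  term : ℕ → ℤ
  term j = (+ j ℤ.- + B) ℤ.* + freq f (+ j ℤ.- + B)
  1+2B≡B+[1+B] : suc (2 * B) ≡ B + suc B
  1+2B≡B+[1+B] = trans (cong (λ x → suc (B + x)) (ℕ.+-identityʳ B)) (sym (ℕ.+-suc B B))
  negative-term : ∀ {j} → j < B → term j ≡ + 0
  negative-term j<B with negative-index j<B
  ... | i , j-B≡-[1+i] rewrite j-B≡-[1+i] | noNeg i = ℤ.*-zeroʳ -[1+ i ]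
  shifted-term : ∀ j → term (B + j) ≡ + (j * mult f j)
  shifted-term j rewrite shifted-index B j = sym (ℤ.pos-* j (mult f j))

weightℕ-cong : ∀ {f g} → f ≋ g → weightℕ f ≡ weightℕ g
weightℕ-cong {f} {g} f≋g = begin
  moment (mult f) (suc (bound f)) ≡⟨ moment-stable (s≤s (ℕ.m≤m+n (bound f) (bound g))) (mult-beyond-bound f) ⟨
  moment (mult f) C               ≡⟨ moment-cong C (λ {j} _ → f≋g (+ j)) ⟩
  moment (mult g) C               ≡⟨ moment-stable (s≤s (ℕ.m≤n+m (bound g) (bound f))) (mult-beyond-bound g) ⟩
  moment (mult g) (suc (bound g)) ∎
  where
  open ≡-Reasoning
  C = suc (bound f + bound g)

weight-cong : ∀ {f g} → NoNegativeParts f → NoNegativeParts g → f ≋ g → weight f ≡ weight g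
weight-cong {f} {g} noNegF noNegG f≋g = begin
  weight f     ≡⟨ weight≡weightℕ f noNegF ⟩
  + weightℕ f  ≡⟨ cong +_ (weightℕ-cong {f} {g} f≋g) ⟩
  + weightℕ g  ≡⟨ weight≡weightℕ g noNegG ⟨
  weight g     ∎
  where open ≡-Reasoning

part*mult≤weightℕ : ∀ f j → j * mult f j ≤ weightℕ f
part*mult≤weightℕ f j with j ℕ.<? suc (bound f)
... | yes j<1+B = term≤moment (mult f) j<1+B
... | no  j≮1+B rewrite mult-beyond-bound f (ℕ.≮⇒≥ j≮1+B) | ℕ.*-zeroʳ j = z≤n

weight+s≡n⇔ : ∀ f {s n} → NoNegativeParts f → (weight f ℤ.+ + s ≡ + n) ⇔ (weightℕ f + s ≡ n)
weight+s≡n⇔ f {s} noNeg = mk⇔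
  (λ w → ℤ.+-injective (trans (cong (ℤ._+ + s) (sym (weight≡weightℕ f noNeg))) w))
  (λ w → trans (cong (ℤ._+ + s) (weight≡weightℕ f noNeg)) (cong +_ w))

-- Levels and the defining conditions

∀-eventually? : ∀ {P : Pred ℕ 0ℓ} → Decidable P → ∀ L → (∀ {i} → L ≤ i → P i) → Dec (∀ i → P i)
∀-eventually? {P} P? L tail = Dec.map′ extend (λ all {i} _ → all i) (ℕ.allUpTo? P? L)
  where
  extend : (∀ {i} → i < L → P i) → ∀ i → P i
  extend below i with i ℕ.<? L
  ... | yes i<L = below i<L
  ... | no  i≮L = tail (ℕ.≮⇒≥ i≮L)

∀ℤ? : ∀ {P : Pred ℤ 0ℓ} → Dec (∀ i → P (+ i)) → Dec (∀ i → P -[1+ i ]) → Dec (∀ i → P i)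
∀ℤ? pos? neg? = Dec.map′ (λ (pos , neg) → λ { (+ i) → pos i ; -[1+ i ] → neg i })
                         (λ all → (λ i → all (+ i)) , (λ i → all -[1+ i ]))
                         (pos? ×-dec neg?)

commonCond? : ∀ a k → Decidable (CommonCond a k)
commonCond? a k f = adjacent? ×-dec noNegativeParts? ×-dec (mult f 0 ℕ.≤? 2 * a) ×-dec evenParts?
  where
  B = bound f
  adjacent? = ∀-eventually? (λ i → mult f i + mult f (suc i) ℕ.≤? k) (suc B) λ {i} B<i →
    subst (_≤ k) (sym (cong₂ _+_ (mult-beyond-bound f B<i) (mult-beyond-bound f (ℕ.m<n⇒m<1+n B<i)))) z≤n
  noNegativeParts? = ∀-eventually? (λ i → freq f -[1+ i ] ℕ.≟ 0) B λ {i} B≤i →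
    finite f -[1+ i ] (s≤s B≤i)
  evenParts? = ∀ℤ?
    (∀-eventually? (λ i → 2 ∣? i →-dec 2 ∣? mult f i) (suc B) λ B<i _ →
       subst (2 ∣_) (sym (mult-beyond-bound f B<i)) (2 ∣0))
    (∀-eventually? (λ i → 2 ∣? suc i →-dec 2 ∣? freq f -[1+ i ]) B λ {i} B≤i _ →
       subst (2 ∣_) (sym (finite f -[1+ i ] (s≤s B≤i))) (2 ∣0))

commonCond-resp : ∀ {a k} → CommonCond a k Respects _≋_
commonCond-resp {a} {k} f≋g (adjacent , noNeg , small₀ , evenParts) =
  (λ i → subst₂ (λ x y → x + y ≤ k) (f≋g (+ i)) (f≋g (+ suc i)) (adjacent i)) ,
  (λ i → trans (sym (f≋g -[1+ i ])) (noNeg i)) ,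
  subst (_≤ 2 * a) (f≋g (+ 0)) small₀ ,
  (λ i 2∣i → subst (2 ∣_) (f≋g i) (evenParts i 2∣i))

level : GFS → ℕ
level f = 2 * mult f 0 + mult f 1

level-cong : ∀ {f g} → f ≋ g → level f ≡ level g
level-cong f≋g = cong₂ (λ x y → 2 * x + y) (f≋g (+ 0)) (f≋g (+ 1))

-- InZe a c k and InZeTilde a b k unfold to Levelled a k R for R an upper bound on the level.
Levelled : (a k : ℕ) → Pred ℕ 0ℓ → Pred GFS 0ℓ
Levelled a k R f = CommonCond a k f × R (level f)

OnLevel : (a k m : ℕ) → Pred GFS 0ℓ
OnLevel a k m = Levelled a k (_≡ m)

levelled? : ∀ {a k R} → Decidable R → Decidable (Levelled a k R)
levelled? {a} {k} R? f = commonCond? a k f ×-dec R? (level f)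

levelled-resp : ∀ {a k R} → Levelled a k R Respects _≋_
levelled-resp {a} {k} {R} {f} {g} f≋g (cc , r) =
  commonCond-resp {a} {k} {f} {g} f≋g cc , subst R (level-cong {f} {g} f≋g) r

-- Finiteness of weight slices

digit : ∀ {B L} → Vec (Fin B) L → ℕ → ℕ
digit []      _       = 0
digit (x ∷ _) zero    = toℕ x
digit (_ ∷ v) (suc j) = digit v j

digit-beyond : ∀ {B L} (v : Vec (Fin B) L) {j} → L ≤ j → digit v j ≡ 0
digit-beyond []      _         = refl
digit-beyond (_ ∷ v) (s≤s L≤j) = digit-beyond v L≤j

fromDigits : ∀ {B L} → Vec (Fin B) L → GFS
fromDigits {L = L} v = record { freq = φ ; bound = L ; finite = φ-finite }
  where
  φ : ℤ → ℕ
  φ (+ j)    = digit v j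
  φ -[1+ _ ] = 0
  φ-finite : ∀ i → L < ∣ i ∣ → φ i ≡ 0
  φ-finite (+ j)    L<j = digit-beyond v (ℕ.<⇒≤ L<j)
  φ-finite -[1+ _ ] _   = refl

toDigits : ∀ {B} L (g : ℕ → ℕ) → (∀ j → g j < B) → Vec (Fin B) L
toDigits zero    g g<B = []
toDigits (suc L) g g<B = fromℕ< (g<B 0) ∷ toDigits L (λ j → g (suc j)) (λ j → g<B (suc j))

digit-toDigits : ∀ {B} L g (g<B : ∀ j → g j < B) {j} → j < L → digit (toDigits L g g<B) j ≡ g j
digit-toDigits (suc L) g g<B {zero}  _         = toℕ-fromℕ< (g<B 0)
digit-toDigits (suc L) g g<B {suc j} (s≤s j<L) =
  digit-toDigits L (λ j → g (suc j)) (λ j → g<B (suc j)) j<L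

toDigits-unique : ∀ {B L} g (g<B : ∀ j → g j < B) (v : Vec (Fin B) L) →
                  (∀ {j} → j < L → g j ≡ digit v j) → toDigits L g g<B ≡ v
toDigits-unique g g<B []      _    = refl
toDigits-unique g g<B (x ∷ v) g≡v =
  cong₂ _∷_ (toℕ-injective (trans (toℕ-fromℕ< (g<B 0)) (g≡v (s≤s z≤n))))
            (toDigits-unique (λ j → g (suc j)) (λ j → g<B (suc j)) v (λ j<L → g≡v (s≤s j<L)))

-- A sequence of weight at most n with f₀ ≤ c vanishes beyond n and has all multiplicities
-- below n + c + 1, so it is determined by n + 1 digits in base n + c + 1.
module _ {P : Pred GFS 0ℓ} (c : ℕ) (P? : Decidable P) (P-resp : P Respects _≋_)
         (P⇒bounded : ∀ {f} → P f → NoNegativeParts f × mult f 0 ≤ c) (s n : ℕ) where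
  private
    B L : ℕ
    B = suc (n + c)
    L = suc n

    InSlice : Pred GFS 0ℓ
    InSlice f = P f × weight f ℤ.+ + s ≡ + n

    weightℕ≤n : ∀ f → InSlice f → weightℕ f ≤ n
    weightℕ≤n f (p , w) =
      ℕ.m+n≤o⇒m≤o (weightℕ f) (ℕ.≤-reflexive (Equivalence.to (weight+s≡n⇔ f (proj₁ (P⇒bounded p))) w))

    mult<B : ∀ f → InSlice f → ∀ j → mult f j < B
    mult<B f (p , _)  zero    = s≤s (ℕ.≤-trans (proj₂ (P⇒bounded p)) (ℕ.m≤n+m _ n))
    mult<B f inSlice (suc j) = s≤s (begin
      mult f (suc j)           ≤⟨ ℕ.m≤n*m (mult f (suc j)) (suc j) ⟩
      suc j * mult f (suc j)   ≤⟨ part*mult≤weightℕ f (suc j) ⟩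
      weightℕ f                ≤⟨ weightℕ≤n f inSlice ⟩
      n                        ≤⟨ ℕ.m≤m+n n c ⟩
      n + c                    ∎)
      where open ℕ.≤-Reasoning

    mult-vanishes : ∀ f → InSlice f → ∀ {j} → L ≤ j → mult f j ≡ 0
    mult-vanishes f inSlice {j} L≤j with mult f j in mult≡
    ... | zero  = refl
    ... | suc m = ⊥-elim (ℕ.<⇒≱ L≤j (begin
      j              ≤⟨ ℕ.m≤m*n j (suc m) ⟩
      j * suc m      ≡⟨ cong (j *_) mult≡ ⟨
      j * mult f j   ≤⟨ part*mult≤weightℕ f j ⟩
      weightℕ f      ≤⟨ weightℕ≤n f inSlice ⟩
      n              ∎))
      where open ℕ.≤-Reasoning

    encode : ∀ f → InSlice f → Vec (Fin B) L
    encode f inSlice = toDigits L (mult f) (mult<B f inSlice)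

    fromDigits-encode : ∀ f (inSlice : InSlice f) → fromDigits (encode f inSlice) ≋ f
    fromDigits-encode f inSlice (+ j) with j ℕ.<? L
    ... | yes j<L = digit-toDigits L (mult f) (mult<B f inSlice) j<L
    ... | no  j≮L =
      trans (digit-beyond (encode f inSlice) (ℕ.≮⇒≥ j≮L)) (sym (mult-vanishes f inSlice (ℕ.≮⇒≥ j≮L)))
    fromDigits-encode f (p , _) -[1+ i ] = sym (proj₁ (P⇒bounded p) i)

    inSlice-resp : ∀ {f g} → f ≋ g → InSlice f → InSlice g
    inSlice-resp {f} {g} f≋g (p , w) = p′ , trans (cong (ℤ._+ + s) weight≡) w
      where
      p′ = P-resp {f} {g} f≋g p
      weight≡ = weight-cong {g} {f} (proj₁ (P⇒bounded p′)) (proj₁ (P⇒bounded p)) (sym ∘ f≋g)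

    digits↔slice : Inverse (Restrict (Vec (Fin B) L) (InSlice ∘ fromDigits)) (WeightSlice P s n)
    digits↔slice = mkInverse
      (λ (v , inSlice) → fromDigits v , inSlice)
      (λ (f , inSlice) → encode f inSlice ,
                         inSlice-resp {f} {fromDigits (encode f inSlice)} (sym ∘ fromDigits-encode f inSlice) inSlice)
      (λ { refl i → refl })
      (λ { {f , inF} {g , inG} f≋g → toDigits-unique (mult f) (mult<B f inF) (encode g inG) λ {j} j<L →
             trans (f≋g (+ j)) (sym (digit-toDigits L (mult g) (mult<B g inG) j<L)) })
      (λ (f , inSlice) → fromDigits-encode f inSlice)
      (λ (v , inSlice) → toDigits-unique _ (mult<B (fromDigits v) inSlice) v (λ _ → refl))

    inSlice? : Decidable {A = Vec (Fin B) L} (InSlice ∘ fromDigits)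
    inSlice? v = P? (fromDigits v) ×-dec (weight (fromDigits v) ℤ.+ + s ℤ.≟ + n)

  weightSlice-finite : Σ ℕ (HasSize (WeightSlice P s n))
  weightSlice-finite with restrict-finite (Vec↔Fin^ L) inSlice?
  ... | m , |digits| = m , inverse |digits| digits↔slice

levelled-finite : ∀ {a k} {R : Pred ℕ 0ℓ} → Decidable R → ∀ s n →
                  Σ ℕ (HasSize (WeightSlice (Levelled a k R) s n))
levelled-finite {a} {k} {R} R? =
  weightSlice-finite (2 * a) (levelled? {a} {k} R?) (λ {f} {g} → levelled-resp {a} {k} {R} {f} {g})
    (λ ((_ , noNeg , small₀ , _) , _) → noNeg , small₀)

inZe-finite : ∀ a c k s n → Σ ℕ (HasSize (WeightSlice (InZe a c k) s n))
inZe-finite a c k = levelled-finite {a} {k} (λ t → + t ℤ.≤? + k ℤ.- + 2 ℤ.* c ℤ.+ + 2 ℤ.* + a)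

inZeTilde-finite : ∀ a b k s n → Σ ℕ (HasSize (WeightSlice (InZeTilde a b k) s n))
inZeTilde-finite a b k =
  levelled-finite {a} {k} (λ t → + t ℤ.≤? + k ℤ.- + 2 ℤ.* + b ℤ.+ + 2 ℤ.* + a ℤ.+ + 1)

onLevel-finite : ∀ a k m s n → Σ ℕ (HasSize (WeightSlice (OnLevel a k m) s n))
onLevel-finite a k m = levelled-finite {a} {k} (ℕ._≟ m)

module _ {P P₁ P₂ : Pred GFS 0ℓ} (split : P ⊆ P₁ ∪ P₂) (P₁⊆P : P₁ ⊆ P) (P₂⊆P : P₂ ⊆ P)
         (disjoint : ∀ {f} → P₁ f → P₂ f → ⊥) (P₁-resp : P₁ Respects _≋_) (P₂-resp : P₂ Respects _≋_)
         (s n : ℕ) where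
  private
    module S     = Setoid (WeightSlice P s n)
    module S₁⊎S₂ = Setoid (WeightSlice P₁ s n ⊎ₛ WeightSlice P₂ s n)

    to : S.Carrier → S₁⊎S₂.Carrier
    to (f , p , w) = Sum.map (λ p₁ → f , p₁ , w) (λ p₂ → f , p₂ , w) (split p)

    from : S₁⊎S₂.Carrier → S.Carrier
    from = Sum.[ (λ (f , p₁ , w) → f , P₁⊆P p₁ , w) , (λ (f , p₂ , w) → f , P₂⊆P p₂ , w) ]

    to-cong : ∀ {x y} → x S.≈ y → to x S₁⊎S₂.≈ to y
    to-cong {f , p , _} {g , q , _} f≋g with split p | split q
    ... | inj₁ _  | inj₁ _  = Pointwise.inj₁ f≋g
    ... | inj₂ _  | inj₂ _  = Pointwise.inj₂ f≋g
    ... | inj₁ p₁ | inj₂ q₂ = ⊥-elim (disjoint (P₁-resp {f} {g} f≋g p₁) q₂)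
    ... | inj₂ p₂ | inj₁ q₁ = ⊥-elim (disjoint q₁ (P₂-resp {f} {g} f≋g p₂))

    from-cong : ∀ {x y} → x S₁⊎S₂.≈ y → from x S.≈ from y
    from-cong (Pointwise.inj₁ f≋g) = f≋g
    from-cong (Pointwise.inj₂ f≋g) = f≋g

    to-from : ∀ y → to (from y) S₁⊎S₂.≈ y
    to-from (inj₁ (f , p₁ , _)) with split (P₁⊆P p₁)
    ... | inj₁ _  = Pointwise.inj₁ λ _ → refl
    ... | inj₂ p₂ = ⊥-elim (disjoint p₁ p₂)
    to-from (inj₂ (f , p₂ , _)) with split (P₂⊆P p₂)
    ... | inj₁ p₁ = ⊥-elim (disjoint p₁ p₂)
    ... | inj₂ _  = Pointwise.inj₂ λ _ → refl

    from-to : ∀ x → from (to x) S.≈ x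
    from-to (f , p , _) with split p
    ... | inj₁ _ = λ _ → refl
    ... | inj₂ _ = λ _ → refl

  weightSlice-⊎ : Inverse (WeightSlice P s n) (WeightSlice P₁ s n ⊎ₛ WeightSlice P₂ s n)
  weightSlice-⊎ = mkInverse to from (λ {x} {y} → to-cong {x} {y}) from-cong to-from from-to

split-top-level : ∀ {a k} {R R′ : Pred ℕ 0ℓ} m → (∀ {t} → R t ⇔ t ≤ m) → (∀ {t} → R′ t ⇔ t < m) →
                  ∀ s n → Inverse (WeightSlice (Levelled a k R) s n)
                                  (WeightSlice (Levelled a k R′) s n ⊎ₛ WeightSlice (OnLevel a k m) s n)
split-top-level {a} {k} {R} {R′} m R⇔≤m R′⇔<m =
  weightSlice-⊎ {Levelled a k R} {Levelled a k R′} {OnLevel a k m} (λ {f} → split {f})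
    (Product.map₂ (R⇔≤m .from ∘ ℕ.<⇒≤ ∘ R′⇔<m .to)) (Product.map₂ λ { refl → R⇔≤m .from ℕ.≤-refl })
    (λ (_ , r′) (_ , t≡m) → ℕ.<-irrefl t≡m (R′⇔<m .to r′))
    (λ {f} {g} → levelled-resp {a} {k} {R′} {f} {g}) (λ {f} {g} → levelled-resp {a} {k} {_≡ m} {f} {g})
  where
  open Equivalence
  split : Levelled a k R ⊆ Levelled a k R′ ∪ OnLevel a k m
  split (cc , r) = Sum.map (cc ,_) (cc ,_) (Sum.map₁ (R′⇔<m .from) (ℕ.m≤n⇒m<n∨m≡n (R⇔≤m .to r)))

-- Raising the multiplicity of the part 1

adjustAt₁ : (ℕ → ℕ) → (ℤ → ℕ) → ℤ → ℕ
adjustAt₁ h φ (+ 1) = h (φ (+ 1))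
adjustAt₁ h φ i     = φ i

adjust₁ : (ℕ → ℕ) → GFS → GFS
adjust₁ h f = record { freq = adjustAt₁ h (freq f) ; bound = suc (bound f) ; finite = vanishes }
  where
  vanishes : ∀ i → suc (bound f) < ∣ i ∣ → adjustAt₁ h (freq f) i ≡ 0
  vanishes (+ 0)           ()
  vanishes (+ 1)           (s≤s ())
  vanishes (+ suc (suc j)) B<i = finite f _ (ℕ.<⇒≤ B<i)
  vanishes -[1+ j ]        B<i = finite f _ (ℕ.<⇒≤ B<i)

adjust₁-cong : ∀ h {f g} → f ≋ g → adjust₁ h f ≋ adjust₁ h g
adjust₁-cong h f≋g (+ 0)           = f≋g (+ 0)
adjust₁-cong h f≋g (+ 1)           = cong h (f≋g (+ 1))
adjust₁-cong h f≋g (+ suc (suc j)) = f≋g _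
adjust₁-cong h f≋g -[1+ j ]        = f≋g _

adjust₁-adjust₁ : ∀ h h′ f → h (h′ (mult f 1)) ≡ mult f 1 → adjust₁ h (adjust₁ h′ f) ≋ f
adjust₁-adjust₁ h h′ f hh′≡id (+ 0)           = refl
adjust₁-adjust₁ h h′ f hh′≡id (+ 1)           = hh′≡id
adjust₁-adjust₁ h h′ f hh′≡id (+ suc (suc j)) = refl
adjust₁-adjust₁ h h′ f hh′≡id -[1+ j ]        = refl

weightℕ-adjust₁ : ∀ h f → weightℕ (adjust₁ h f) + mult f 1 ≡ weightℕ f + h (mult f 1)
weightℕ-adjust₁ h f = begin
  moment (mult f′) (2 + B) + mult f 1        ≡⟨ cong (λ x → moment (mult f′) (2 + B) + x) (ℕ.*-identityˡ _) ⟨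
  moment (mult f′) (2 + B) + 1 * mult f 1    ≡⟨ moment-update (2 + B) (s≤s (s≤s z≤n)) elsewhere ⟩
  moment (mult f) (2 + B) + 1 * h (mult f 1) ≡⟨ cong₂ _+_ (moment-stable (ℕ.n≤1+n _) (mult-beyond-bound f))
                                                          (ℕ.*-identityˡ _) ⟩
  moment (mult f) (suc B) + h (mult f 1)     ∎
  where
  open ≡-Reasoning
  B  = bound f
  f′ = adjust₁ h f
  elsewhere : ∀ {j} → j ≢ 1 → mult f′ j ≡ mult f j
  elsewhere {0}           _   = refl
  elsewhere {1}           1≢1 = ⊥-elim (1≢1 refl)
  elsewhere {suc (suc j)} _   = refl

adjust₁-commonCond : ∀ {a k} h f → CommonCond a k f →
                     mult f 0 + h (mult f 1) ≤ k → h (mult f 1) + mult f 2 ≤ k → CommonCond a k (adjust₁ h f)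
adjust₁-commonCond h f (adjacent , noNeg , small₀ , evenParts) adjacent₀ adjacent₁ =
  adjacent′ , noNeg , small₀ , evenParts′
  where
  adjacent′ : ∀ i → mult (adjust₁ h f) i + mult (adjust₁ h f) (suc i) ≤ _
  adjacent′ 0             = adjacent₀
  adjacent′ 1             = adjacent₁
  adjacent′ (suc (suc i)) = adjacent (suc (suc i))
  evenParts′ : ∀ i → + 2 ℤ∣ i → 2 ∣ freq (adjust₁ h f) i
  evenParts′ (+ 0)           2∣i = evenParts (+ 0) 2∣i
  evenParts′ (+ 1)           2∣1 = contradiction (∣1⇒≡1 2∣1) λ ()
  evenParts′ (+ suc (suc j)) 2∣i = evenParts _ 2∣i
  evenParts′ -[1+ j ]        2∣i = evenParts _ 2∣i

raise lower : GFS → GFS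
raise = adjust₁ suc
lower = adjust₁ pred

lower-raise : ∀ f → lower (raise f) ≋ f
lower-raise f = adjust₁-adjust₁ pred suc f refl

raise-lower : ∀ g → mult g 1 ≢ 0 → raise (lower g) ≋ g
raise-lower g mult₁≢0 = adjust₁-adjust₁ suc pred g (ℕ.suc-pred (mult g 1) {{≢-nonZero mult₁≢0}})

level-raise : ∀ f → level (raise f) ≡ suc (level f)
level-raise f = ℕ.+-suc (2 * mult f 0) (mult f 1)

level-lower : ∀ g → mult g 1 ≢ 0 → suc (level (lower g)) ≡ level g
level-lower g mult₁≢0 =
  trans (sym (level-raise (lower g))) (level-cong {raise (lower g)} {g} (raise-lower g mult₁≢0))

weightℕ-raise : ∀ f → weightℕ (raise f) ≡ weightℕ f + 1
weightℕ-raise f = ℕ.+-cancelʳ-≡ (mult f 1) _ _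
  (trans (weightℕ-adjust₁ suc f) (sym (ℕ.+-assoc (weightℕ f) 1 (mult f 1))))

weight-raise : ∀ f {s} → NoNegativeParts f → weight (raise f) ℤ.+ + s ≡ weight f ℤ.+ + suc s
weight-raise f {s} noNeg = begin
  weight (raise f) ℤ.+ + s    ≡⟨ cong (ℤ._+ + s) (weight≡weightℕ (raise f) noNeg) ⟩
  + weightℕ (raise f) ℤ.+ + s ≡⟨ cong (λ w → + (w + s)) (weightℕ-raise f) ⟩
  + (weightℕ f + 1 + s)       ≡⟨ cong +_ (ℕ.+-assoc (weightℕ f) 1 s) ⟩
  + (weightℕ f + suc s)       ≡⟨ cong (ℤ._+ + suc s) (weight≡weightℕ f noNeg) ⟨
  weight f ℤ.+ + suc s        ∎
  where open ≡-Reasoning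

weight-lower : ∀ g {s} → NoNegativeParts g → mult g 1 ≢ 0 → weight (lower g) ℤ.+ + suc s ≡ weight g ℤ.+ + s
weight-lower g {s} noNeg mult₁≢0 = trans (sym (weight-raise (lower g) noNeg))
  (cong (ℤ._+ + s) (weight-cong {raise (lower g)} {g} noNeg noNeg (raise-lower g mult₁≢0)))

even-level+k : ∀ {a k} f → CommonCond a k f → mult f 0 + mult f 1 ≡ k ⊎ mult f 1 + mult f 2 ≡ k →
               2 ∣ level f + k
even-level+k f (_ , _ , _ , evenParts) (inj₁ refl) =
  subst (2 ∣_) (sym (regroup (mult f 0) (mult f 1)))
    (∣m∣n⇒∣m+n (m∣m*n (mult f 0 + mult f 1)) (evenParts (+ 0) (2 ∣0)))
  where
  regroup : ∀ x y → 2 * x + y + (x + y) ≡ 2 * (x + y) + x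
  regroup = solve-∀
even-level+k f (_ , _ , _ , evenParts) (inj₂ refl) =
  subst (2 ∣_) (sym (regroup (mult f 0) (mult f 1) (mult f 2)))
    (∣m∣n⇒∣m+n (m∣m*n (mult f 0 + mult f 1)) (evenParts (+ 2) ∣-refl))
  where
  regroup : ∀ x y z → 2 * x + y + (y + z) ≡ 2 * (x + y) + z
  regroup = solve-∀

-- The threshold level T

≤-bound⇔ : ∀ {X m t} → X ≡ + m → (+ t ℤ.≤ X) ⇔ t ≤ m
≤-bound⇔ refl = mk⇔ ℤ.drop‿+≤+ ℤ.+≤+

<suc-bound⇔ : ∀ {X m t} → X ≡ + m → (+ t ℤ.≤ X) ⇔ t < suc m
<suc-bound⇔ refl = mk⇔ (s≤s ∘ ℤ.drop‿+≤+) (ℤ.+≤+ ∘ s≤s⁻¹)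

<-bound⇔ : ∀ {X m t} → X ≡ ℤ.pred (+ m) → (+ t ℤ.≤ X) ⇔ t < m
<-bound⇔ refl = mk⇔ (ℤ.drop‿+<+ ∘ ℤ.i≤pred[j]⇒i<j) (ℤ.i<j⇒i≤pred[j] ∘ ℤ.+<+)

threshold : ∀ {a b k} → 2 * a + 2 * b ∸ 1 ≤ k → Σ ℕ λ T → 2 * b + T ≡ k + 2 * a + 1 × 2 * (2 * a) ≤ T
threshold {a} {b} {k} hk with ℕ.m≤n⇒∃[o]m+o≡n (ℕ.≤-trans (ℕ.m≤n+m∸n (2 * a + 2 * b) 1) (s≤s hk))
... | d , 2a+2b+d≡1+k = 2 * (2 * a) + d , balance , ℕ.m≤m+n _ d
  where
  open ≡-Reasoning
  regroup₁ : ∀ a b d → 2 * b + (2 * (2 * a) + d) ≡ 2 * a + 2 * b + d + 2 * a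
  regroup₁ = solve-∀
  regroup₂ : ∀ k a → suc k + 2 * a ≡ k + 2 * a + 1
  regroup₂ = solve-∀
  balance : 2 * b + (2 * (2 * a) + d) ≡ k + 2 * a + 1
  balance = begin
    2 * b + (2 * (2 * a) + d) ≡⟨ regroup₁ a b d ⟩
    2 * a + 2 * b + d + 2 * a ≡⟨ cong (λ x → x + 2 * a) 2a+2b+d≡1+k ⟩
    suc k + 2 * a             ≡⟨ regroup₂ k a ⟩
    k + 2 * a + 1             ∎

module Threshold {a b k T : ℕ} (balance : 2 * b + T ≡ k + 2 * a + 1) (room : 2 * (2 * a) ≤ T) where

  odd-T+k : ¬ 2 ∣ T + k
  odd-T+k 2∣T+k = contradiction (∣1⇒≡1 (∣m+n∣m⇒∣n 2∣2[k+a]+1 (m∣m*n (k + a)))) λ ()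
    where
    open ≡-Reasoning
    regroup₁ : ∀ T k b → T + k + 2 * b ≡ 2 * b + T + k
    regroup₁ = solve-∀
    regroup₂ : ∀ k a → k + 2 * a + 1 + k ≡ 2 * (k + a) + 1
    regroup₂ = solve-∀
    2∣2[k+a]+1 : 2 ∣ 2 * (k + a) + 1
    2∣2[k+a]+1 = subst (2 ∣_) (begin
      T + k + 2 * b     ≡⟨ regroup₁ T k b ⟩
      2 * b + T + k     ≡⟨ cong (_+ k) balance ⟩
      k + 2 * a + 1 + k ≡⟨ regroup₂ k a ⟩
      2 * (k + a) + 1   ∎) (∣m∣n⇒∣m+n 2∣T+k (m∣m*n b))

  raise-commonCond : ∀ f → CommonCond a k f → level f ≡ T → CommonCond a k (raise f)
  raise-commonCond f cc@(adjacent , _) level≡T = adjust₁-commonCond {a} {k} suc f cc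
    (subst (_≤ k) (sym (ℕ.+-suc _ _)) (ℕ.≤∧≢⇒< (adjacent 0) (tight ∘ inj₁)))
    (ℕ.≤∧≢⇒< (adjacent 1) (tight ∘ inj₂))
    where
    tight : ¬ (mult f 0 + mult f 1 ≡ k ⊎ mult f 1 + mult f 2 ≡ k)
    tight e = odd-T+k (subst (λ t → 2 ∣ t + k) level≡T (even-level+k {a} f cc e))

  lower-commonCond : ∀ g → CommonCond a k g → CommonCond a k (lower g)
  lower-commonCond g cc@(adjacent , _) = adjust₁-commonCond {a} {k} pred g cc
    (ℕ.≤-trans (ℕ.+-monoʳ-≤ (mult g 0) ℕ.pred[n]≤n) (adjacent 0))
    (ℕ.≤-trans (ℕ.+-monoˡ-≤ (mult g 2) ℕ.pred[n]≤n) (adjacent 1))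

  above-T⇒mult₁≢0 : ∀ g → CommonCond a k g → level g ≡ suc T → mult g 1 ≢ 0
  above-T⇒mult₁≢0 g (_ , _ , small₀ , _) level≡1+T mult₁≡0 = ℕ.1+n≰n (begin
    suc T            ≡⟨ level≡1+T ⟨
    level g          ≡⟨ cong (λ x → 2 * mult g 0 + x) mult₁≡0 ⟩
    2 * mult g 0 + 0 ≡⟨ ℕ.+-identityʳ _ ⟩
    2 * mult g 0     ≤⟨ ℕ.*-monoʳ-≤ 2 small₀ ⟩
    2 * (2 * a)      ≤⟨ room ⟩
    T                ∎)
    where open ℕ.≤-Reasoning

  raise-inverse : ∀ n → Inverse (WeightSlice (OnLevel a k T) 1 n) (WeightSlice (OnLevel a k (suc T)) 0 n)
  raise-inverse n = mkInverse to from
    (λ {x} {y} → adjust₁-cong suc {proj₁ x} {proj₁ y}) (λ {x} {y} → adjust₁-cong pred {proj₁ x} {proj₁ y})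
    (λ (g , (cc , level≡1+T) , _) → raise-lower g (above-T⇒mult₁≢0 g cc level≡1+T))
    (λ (f , _) → lower-raise f)
    where
    to : Setoid.Carrier (WeightSlice (OnLevel a k T) 1 n) →
         Setoid.Carrier (WeightSlice (OnLevel a k (suc T)) 0 n)
    to (f , (cc@(_ , noNeg , _) , level≡T) , w) =
      raise f , (raise-commonCond f cc level≡T , trans (level-raise f) (cong suc level≡T)) ,
      trans (weight-raise f noNeg) w
    from : Setoid.Carrier (WeightSlice (OnLevel a k (suc T)) 0 n) →
           Setoid.Carrier (WeightSlice (OnLevel a k T) 1 n)
    from (g , (cc@(_ , noNeg , _) , level≡1+T) , w) =
      lower g , (lower-commonCond g cc , ℕ.suc-injective (trans (level-lower g mult₁≢0) level≡1+T)) ,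
      trans (weight-lower g noNeg mult₁≢0) w
      where mult₁≢0 = above-T⇒mult₁≢0 g cc level≡1+T

  InZeTilde-bound : + k ℤ.- + 2 ℤ.* + b ℤ.+ + 2 ℤ.* + a ℤ.+ + 1 ≡ + T
  InZeTilde-bound = begin
    + k ℤ.- + 2 ℤ.* + b ℤ.+ + 2 ℤ.* + a ℤ.+ + 1 ≡⟨ regroup (+ k) (+ a) (+ b) ⟩
    + k ℤ.+ + 2 ℤ.* + a ℤ.+ + 1 ℤ.- + 2 ℤ.* + b ≡⟨ cong₂ (λ x y → + k ℤ.+ x ℤ.+ + 1 ℤ.- y)
                                                         (ℤ.pos-* 2 a) (ℤ.pos-* 2 b) ⟨
    + (k + 2 * a + 1) ℤ.- + (2 * b)             ≡⟨ cong (λ x → + x ℤ.- + (2 * b)) balance ⟨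
    + (2 * b + T) ℤ.- + (2 * b)                 ≡⟨ cong (ℤ._- + (2 * b)) (ℤ.pos-+ (2 * b) T) ⟩
    + (2 * b) ℤ.+ + T ℤ.- + (2 * b)             ≡⟨ cancel (+ (2 * b)) (+ T) ⟩
    + T                                         ∎
    where
    open ≡-Reasoning
    regroup : ∀ k a b → k ℤ.- + 2 ℤ.* b ℤ.+ + 2 ℤ.* a ℤ.+ + 1 ≡ k ℤ.+ + 2 ℤ.* a ℤ.+ + 1 ℤ.- + 2 ℤ.* b
    regroup = ℤ-solve-∀
    cancel : ∀ x y → x ℤ.+ y ℤ.- x ≡ y
    cancel = ℤ-solve-∀

  InZe[b-1]-bound : + k ℤ.- + 2 ℤ.* (+ b ℤ.- + 1) ℤ.+ + 2 ℤ.* + a ≡ + suc T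
  InZe[b-1]-bound =
    trans (regroup (+ k) (+ a) (+ b)) (trans (cong (ℤ._+ + 1) InZeTilde-bound) (cong +_ (ℕ.+-comm T 1)))
    where
    regroup : ∀ k a b → k ℤ.- + 2 ℤ.* (b ℤ.- + 1) ℤ.+ + 2 ℤ.* a ≡
                        k ℤ.- + 2 ℤ.* b ℤ.+ + 2 ℤ.* a ℤ.+ + 1 ℤ.+ + 1
    regroup = ℤ-solve-∀

  InZe[b]-bound : + k ℤ.- + 2 ℤ.* + b ℤ.+ + 2 ℤ.* + a ≡ ℤ.pred (+ T)
  InZe[b]-bound = trans (regroup (+ k) (+ a) (+ b)) (cong ℤ.pred InZeTilde-bound)
    where
    regroup : ∀ k a b → k ℤ.- + 2 ℤ.* b ℤ.+ + 2 ℤ.* a ≡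
                        ℤ.- + 1 ℤ.+ (k ℤ.- + 2 ℤ.* b ℤ.+ + 2 ℤ.* a ℤ.+ + 1)
    regroup = ℤ-solve-∀

  InZe[b-1]-split : ∀ s n → Inverse (WeightSlice (InZe a (+ b ℤ.- + 1) k) s n)
                                    (WeightSlice (InZeTilde a b k) s n ⊎ₛ WeightSlice (OnLevel a k (suc T)) s n)
  InZe[b-1]-split = split-top-level {a} {k} (suc T) (≤-bound⇔ InZe[b-1]-bound) (<suc-bound⇔ InZeTilde-bound)

  InZeTilde-split : ∀ s n → Inverse (WeightSlice (InZeTilde a b k) s n)
                                    (WeightSlice (InZe a (+ b) k) s n ⊎ₛ WeightSlice (OnLevel a k T) s n)
  InZeTilde-split = split-top-level {a} {k} T (≤-bound⇔ InZeTilde-bound) (<-bound⇔ InZe[b]-bound)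

  size-identity : ∀ {n t₀ t₁ u₀ u₁ e₀ e₁} →
                  HasSize (WeightSlice (InZeTilde a b k) 0 n) t₀ →
                  HasSize (WeightSlice (InZeTilde a b k) 1 n) t₁ →
                  HasSize (WeightSlice (InZe a (+ b ℤ.- + 1) k) 0 n) u₀ →
                  HasSize (WeightSlice (InZe a (+ b) k) 1 n) u₁ →
                  HasSize (WeightSlice (OnLevel a k (suc T)) 0 n) e₀ →
                  HasSize (WeightSlice (OnLevel a k T) 1 n) e₁ →
                  t₀ + t₁ ≡ u₀ + u₁
  size-identity {n} {t₀} {t₁} {u₀} {u₁} {e₀} {e₁} |Z̃₀| |Z̃₁| |Z₀| |Z₁| |E₀| |E₁| = begin
    t₀ + t₁        ≡⟨ cong (λ x → t₀ + x) (size-transport (InZeTilde-split 1 n) |Z̃₁| (HasSize-⊎ |Z₁| |E₁|)) ⟩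
    t₀ + (u₁ + e₁) ≡⟨ cong (λ x → t₀ + (u₁ + x)) (size-transport (raise-inverse n) |E₁| |E₀|) ⟩
    t₀ + (u₁ + e₀) ≡⟨ x∙yz≈xz∙y t₀ u₁ e₀ ⟩
    t₀ + e₀ + u₁   ≡⟨ cong (λ x → x + u₁) (size-transport (InZe[b-1]-split 0 n) |Z₀| (HasSize-⊎ |Z̃₀| |E₀|)) ⟨
    u₀ + u₁        ∎
    where open ≡-Reasoning

proposition5p4 : (a b k : ℕ) → 1 ≤ b → 2 * a + 2 * b ∸ 1 ≤ k → (n : ℕ) →
    Σ ℕ λ t₀ → Σ ℕ λ t₁ → Σ ℕ λ u₀ → Σ ℕ λ u₁ →
      HasSize (WeightSlice (InZeTilde a b k) 0 n) t₀
      × HasSize (WeightSlice (InZeTilde a b k) 1 n) t₁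
      × HasSize (WeightSlice (InZe a (+ b ℤ.- + 1) k) 0 n) u₀
      × HasSize (WeightSlice (InZe a (+ b) k) 1 n) u₁
      × t₀ + t₁ ≡ u₀ + u₁
proposition5p4 a b k _ hk n
  with threshold {a} {b} {k} hk
     | inZeTilde-finite a b k 0 n | inZeTilde-finite a b k 1 n
     | inZe-finite a (+ b ℤ.- + 1) k 0 n | inZe-finite a (+ b) k 1 n
... | T , balance , room | t₀ , |Z̃₀| | t₁ , |Z̃₁| | u₀ , |Z₀| | u₁ , |Z₁| =
  t₀ , t₁ , u₀ , u₁ , |Z̃₀| , |Z̃₁| , |Z₀| , |Z₁| ,
  Threshold.size-identity {a} {b} {k} balance room |Z̃₀| |Z̃₁| |Z₀| |Z₁|
    (proj₂ (onLevel-finite a k (suc T) 0 n)) (proj₂ (onLevel-finite a k T 1 n))
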